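{- Let $G$ be a finite simple graph, with $(H,H')$, $M$, $M_A$ as in the standing setting below. Then each edge of $M_A\setminus H'$ is adjacent to two edges of $H'$.
   Context: $\nu(G)$ is the maximum matching size. $B_2(G)$ is the set of pairs $(H,H')$ of edge-disjoint matchings; $\lambda_2(G)=\max\{|H|+|H'|:(H,H')\in B_2(G)\}$; $\alpha_2(G)=\max\{|H|,|H'|:(H,H')\in B_2(G),\ |H|+|H'|=\lambda_2(G)\}$; $M_2(G)=\{(H,H')\in B_2(G): |H|+|H'|=\lambda_2(G),\ |H|=\alpha_2(G)\}$. For matchings $A,B$: a path or even cycle $e_1,\dots,e_l$ ($l\ge1$) is $A$-$B$ alternating if the edges with odd indices lie in $A\setminus B$ and the others in $B\setminus A$, or vice versa; an alternating path is maximal if it is not a proper subpath of another $A$-$B$ alternating path. $P_o^A(A,B)$ is the set of maximal $A$-$B$ alternating paths of odd length whose first edge is in $A$. Standing setting: over all $(H,H')\in M_2(G)$ and all maximum matchings $M$ of $G$, consider the triples maximizing $|M\cap H|$; among these, $((H,H'),M)$ is chosen to maximize $|M\cap H'|$. $M_A$ is the set of edges lying on paths of $P_o^M(M,H)$ that belong to $M$. -}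

module Defs where

open import Data.Nat using (ℕ; zero; suc; _+_; _≤_; _<_; _%_)
open import Data.Fin using (Fin; toℕ; inject₁) renaming (suc to fsuc)
open import Data.Fin.Subset using (Subset; _∈_; _∉_; ∣_∣; _∩_)
open import Data.Product using (Σ; ∃; ∃-syntax; _×_; _,_)
open import Data.Sum using (_⊎_)
open import Relation.Binary.PropositionalEquality using (_≡_; _≢_)
open import Relation.Nullary using (¬_)
open import Function.Definitions using (Injective)

record Graph : Set where
  field
    n   : ℕ
    m   : ℕ
    src : Fin m → Fin n
    tgt : Fin m → Fin n
    noLoop     : ∀ e → src e ≢ tgt e
    noParallel : ∀ e f → e ≢ f →
                 ¬ ((src e ≡ src f × tgt e ≡ tgt f) ⊎ (src e ≡ tgt f × tgt e ≡ src f))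

module _ (G : Graph) where
  open Graph G

  EdgeSet : Set
  EdgeSet = Subset m

  Incident : Fin n → Fin m → Set
  Incident v e = v ≡ src e ⊎ v ≡ tgt e

  ShareEnd : Fin m → Fin m → Set
  ShareEnd e f = ∃[ v ] (Incident v e × Incident v f)

  Adjacent : Fin m → Fin m → Set
  Adjacent e f = e ≢ f × ShareEnd e f

  IsMatching : EdgeSet → Set
  IsMatching H = ∀ e f → e ∈ H → f ∈ H → e ≢ f → ¬ ShareEnd e f

  IsMaximumMatching : EdgeSet → Set
  IsMaximumMatching M = IsMatching M × (∀ N → IsMatching N → ∣ N ∣ ≤ ∣ M ∣)

  InB2 : EdgeSet → EdgeSet → Set
  InB2 H H' = IsMatching H × IsMatching H' × (∀ e → e ∈ H → e ∉ H')

  MaxSum : EdgeSet → EdgeSet → Set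
  MaxSum H H' = InB2 H H' × (∀ K K' → InB2 K K' → ∣ K ∣ + ∣ K' ∣ ≤ ∣ H ∣ + ∣ H' ∣)

  -- (H , H') ∈ M₂(G): |H| + |H'| = λ₂(G) and |H| = α₂(G), where α₂(G) is the
  -- maximum of |K| and |K'| over pairs (K , K') ∈ B₂(G) with |K|+|K'| = λ₂(G)
  InM2 : EdgeSet → EdgeSet → Set
  InM2 H H' = MaxSum H H' × (∀ K K' → MaxSum K K' → ∣ K ∣ ≤ ∣ H ∣ × ∣ K' ∣ ≤ ∣ H ∣)

  Joins : Fin m → Fin n → Fin n → Set
  Joins e u v = (src e ≡ u × tgt e ≡ v) ⊎ (src e ≡ v × tgt e ≡ u)

  record Path : Set where
    field
      len     : ℕ
      len≥1   : 1 ≤ len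
      vert    : Fin (suc len) → Fin n
      vertInj : Injective _≡_ _≡_ vert
      edge    : Fin len → Fin m
      joins   : ∀ i → Joins (edge i) (vert (inject₁ i)) (vert (fsuc i))
  open Path public

  InDiff : EdgeSet → EdgeSet → Fin m → Set
  InDiff A B e = e ∈ A × e ∉ B

  -- edges with odd (1-based) index in X ∖ Y, the others in Y ∖ X.
  -- 1-based odd index = 0-based even index.
  AltFrom : EdgeSet → EdgeSet → Path → Set
  AltFrom X Y P = ∀ i → (toℕ i % 2 ≡ 0 → InDiff X Y (edge P i))
                      × (toℕ i % 2 ≡ 1 → InDiff Y X (edge P i))

  Alternating : EdgeSet → EdgeSet → Path → Set
  Alternating A B P = AltFrom A B P ⊎ AltFrom B A P

  -- P is a proper subpath of Q: its edge sequence is a strictly shorter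
  -- contiguous segment of that of Q (in either direction)
  ProperSubpath : Path → Path → Set
  ProperSubpath P Q = len P < len Q × (∃[ k ] (k + len P ≤ len Q ×
      ((∀ i j → toℕ j ≡ k + toℕ i → edge P i ≡ edge Q j)
     ⊎ (∀ i j → toℕ j + toℕ i + 1 ≡ k + len P → edge P i ≡ edge Q j))))

  MaximalAlternating : EdgeSet → EdgeSet → Path → Set
  MaximalAlternating A B P = Alternating A B P ×
    ¬ (Σ Path λ Q → Alternating A B Q × ProperSubpath P Q)

  InPoA : EdgeSet → EdgeSet → Path → Set
  InPoA A B P = MaximalAlternating A B P × len P % 2 ≡ 1
              × (∀ (i : Fin (len P)) → toℕ i ≡ 0 → edge P i ∈ A)

  InMA : EdgeSet → EdgeSet → Fin m → Set
  InMA M H e = e ∈ M × (Σ Path λ P → InPoA M H P × ∃[ i ] edge P i ≡ e)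

  StandingSetting : EdgeSet → EdgeSet → EdgeSet → Set
  StandingSetting H H' M = InM2 H H' × IsMaximumMatching M ×
    (∀ K K' N → InM2 K K' → IsMaximumMatching N →
       ∣ N ∩ K ∣ ≤ ∣ M ∩ H ∣ × (∣ N ∩ K ∣ ≡ ∣ M ∩ H ∣ → ∣ N ∩ K' ∣ ≤ ∣ M ∩ H' ∣))

-- An edge e of M_A lies on an M-H alternating path as an M-edge, so e ∉ H. If an endpoint
-- of e were not covered by H', there would be a better pair than (H , H'): if neither is
-- covered, H' ∪ {e} is a larger matching disjoint from H, contradicting λ₂; if exactly one
-- is covered, by f ∈ H', then (H' ∖ {f}) ∪ {e} keeps (H , ·) in M₂ while meeting M in one
-- more edge (f ∉ M as f meets e ∈ M), contradicting the choice of the triple. So both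
-- endpoints are covered by H', and the two covering edges differ as G is simple.
module Submission where

open import Defs
open import Data.Fin using (Fin; zero; suc; toℕ)
open import Data.Fin.Properties using (any?) renaming (_≟_ to _≟ᶠ_)
open import Data.Fin.Subset
  using (Subset; inside; outside; _∈_; _∉_; _⊆_; _⊂_; ∣_∣; _∩_; _∪_; _-_; ⁅_⁆)
open import Data.Fin.Subset.Properties
  using (_∈?_; x∈⁅x⁆; x∈⁅y⁆⇒x≡y; x∈p∪q⁺; x∈p∪q⁻; p⊆p∪q; x∈p∩q⁺; x∈p∩q⁻; p─q⊆p;
         x∈p∧x≢y⇒x∈p-y; p─⊥≡p; p⊂q⇒∣p∣<∣q∣)
open import Data.Vec using (_∷_; here; there)
open import Data.Nat using (suc; _%_; _≤_; _<_; s≤s)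
open import Data.Nat.Properties using (≤-trans; <-≤-trans; +-monoʳ-≤; +-monoʳ-<; <-irrefl)
open import Data.Nat.DivMod using (m%n<n)
open import Data.Product using (∃-syntax; _×_; _,_; proj₁; proj₂)
open import Data.Sum using (_⊎_; inj₁; inj₂; [_,_]′)
open import Data.Empty using (⊥-elim)
open import Function using (_∘_)
open import Relation.Binary.PropositionalEquality using (_≡_; _≢_; refl; sym; trans; cong; subst)
open import Relation.Nullary using (¬_; Dec; yes; no; contradiction)
open import Relation.Nullary.Decidable using (_×-dec_; _⊎-dec_)

n%2≡0⊎n%2≡1 : ∀ n → n % 2 ≡ 0 ⊎ n % 2 ≡ 1
n%2≡0⊎n%2≡1 n with n % 2 | m%n<n n 2
... | 0 | _ = inj₁ refl
... | 1 | _ = inj₂ refl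
... | suc (suc _) | s≤s (s≤s ())

x∈p⇒∣p∣≡suc∣p-x∣ : ∀ {k} {x : Fin k} {p : Subset k} → x ∈ p → ∣ p ∣ ≡ suc ∣ p - x ∣
x∈p⇒∣p∣≡suc∣p-x∣ {x = zero} {p = inside ∷ p} here = cong (suc ∘ ∣_∣) (sym (p─⊥≡p p))
x∈p⇒∣p∣≡suc∣p-x∣ {x = suc x} {p = inside ∷ p} (there x∈p) = cong suc (x∈p⇒∣p∣≡suc∣p-x∣ x∈p)
x∈p⇒∣p∣≡suc∣p-x∣ {x = suc x} {p = outside ∷ p} (there x∈p) = x∈p⇒∣p∣≡suc∣p-x∣ x∈p

x∉p-x : ∀ {k} (x : Fin k) (p : Subset k) → x ∉ p - x
x∉p-x zero (_ ∷ p) ()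
x∉p-x (suc x) (_ ∷ p) (there x∈p-x) = x∉p-x x p x∈p-x

x∉p⇒p⊂p∪⁅x⁆ : ∀ {k} {x : Fin k} {p : Subset k} → x ∉ p → p ⊂ p ∪ ⁅ x ⁆
x∉p⇒p⊂p∪⁅x⁆ {x = x} x∉p = p⊆p∪q ⁅ x ⁆ , x , x∈p∪q⁺ (inj₂ (x∈⁅x⁆ x)) , x∉p

x∈p∪⁅y⁆⇒x∈p⊎x≡y : ∀ {k} {x y : Fin k} {p : Subset k} → x ∈ p ∪ ⁅ y ⁆ → x ∈ p ⊎ x ≡ y
x∈p∪⁅y⁆⇒x∈p⊎x≡y {y = y} {p} x∈ = [ inj₁ , inj₂ ∘ x∈⁅y⁆⇒x≡y y ]′ (x∈p∪q⁻ p ⁅ y ⁆ x∈)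

module _ (G : Graph) where
  open Graph G

  Covered : EdgeSet G → Fin n → Set
  Covered P v = ∃[ g ] (g ∈ P × Incident G v g)

  covered? : ∀ P v → Dec (Covered P v)
  covered? P v = any? (λ g → (g ∈? P) ×-dec ((v ≟ᶠ src g) ⊎-dec (v ≟ᶠ tgt g)))

  Addable : EdgeSet G → Fin m → Set
  Addable P e = ∀ g → g ∈ P → ¬ ShareEnd G e g

  shareEnd-sym : ∀ {e f} → ShareEnd G e f → ShareEnd G f e
  shareEnd-sym (v , ve , vf) = v , vf , ve

  shareEnd-refl : ∀ e → ShareEnd G e e
  shareEnd-refl e = src e , inj₁ refl , inj₁ refl

  addable⇒∉ : ∀ {P e} → Addable P e → e ∉ P
  addable⇒∉ {e = e} add e∈P = add e e∈P (shareEnd-refl e)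

  joins⇒incident : ∀ {e v w} → Joins G e v w → Incident G v e
  joins⇒incident (inj₁ (refl , _)) = inj₁ refl
  joins⇒incident (inj₂ (_ , refl)) = inj₂ refl

  joins⇒shareEnd-at : ∀ {e v w g} → Joins G e v w → ShareEnd G e g →
    Incident G v g ⊎ Incident G w g
  joins⇒shareEnd-at (inj₁ (refl , _)) (_ , inj₁ refl , ug) = inj₁ ug
  joins⇒shareEnd-at (inj₁ (_ , refl)) (_ , inj₂ refl , ug) = inj₂ ug
  joins⇒shareEnd-at (inj₂ (refl , _)) (_ , inj₁ refl , ug) = inj₂ ug
  joins⇒shareEnd-at (inj₂ (_ , refl)) (_ , inj₂ refl , ug) = inj₁ ug

  incident-to-both-ends⇒≡ : ∀ {e f} → Incident G (src e) f → Incident G (tgt e) f → e ≡ f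
  incident-to-both-ends⇒≡ {e} {f} sf tf with e ≟ᶠ f
  ... | yes e≡f = e≡f
  ... | no e≢f = ⊥-elim (noParallel e f e≢f (ends sf tf))
    where
    ends : Incident G (src e) f → Incident G (tgt e) f →
      (src e ≡ src f × tgt e ≡ tgt f) ⊎ (src e ≡ tgt f × tgt e ≡ src f)
    ends (inj₁ s) (inj₁ t) = contradiction (trans s (sym t)) (noLoop e)
    ends (inj₁ s) (inj₂ t) = inj₁ (s , t)
    ends (inj₂ s) (inj₁ t) = inj₂ (s , t)
    ends (inj₂ s) (inj₂ t) = contradiction (trans s (sym t)) (noLoop e)

  ⊆-isMatching : ∀ {P Q} → Q ⊆ P → IsMatching G P → IsMatching G Q
  ⊆-isMatching Q⊆P matP g h g∈ h∈ = matP g h (Q⊆P g∈) (Q⊆P h∈)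

  ∪⁅⁆-isMatching : ∀ {P e} → IsMatching G P → Addable P e → IsMatching G (P ∪ ⁅ e ⁆)
  ∪⁅⁆-isMatching matP add g h g∈ h∈ g≢h
    with x∈p∪⁅y⁆⇒x∈p⊎x≡y g∈ | x∈p∪⁅y⁆⇒x∈p⊎x≡y h∈
  ... | inj₁ g∈P | inj₁ h∈P = matP g h g∈P h∈P g≢h
  ... | inj₁ g∈P | inj₂ refl = add g g∈P ∘ shareEnd-sym
  ... | inj₂ refl | inj₁ h∈P = add h h∈P
  ... | inj₂ refl | inj₂ refl = contradiction refl g≢h

  ∪⁅⁆-inB2 : ∀ {H K L e} → InB2 G H K → L ⊆ K → Addable L e → e ∉ H → InB2 G H (L ∪ ⁅ e ⁆)
  ∪⁅⁆-inB2 {H} {K} {L} {e} (matH , matK , disj) L⊆K add e∉H =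
    matH , ∪⁅⁆-isMatching (⊆-isMatching L⊆K matK) add , disjoint
    where
    disjoint : ∀ g → g ∈ H → g ∉ L ∪ ⁅ e ⁆
    disjoint g g∈H g∈ with x∈p∪⁅y⁆⇒x∈p⊎x≡y g∈
    ... | inj₁ g∈L = disj g g∈H (L⊆K g∈L)
    ... | inj₂ refl = e∉H g∈H

  alternating-∈A⇒∉B : ∀ {A B P} → Alternating G A B P → ∀ i →
    edge P i ∈ A → edge P i ∉ B
  alternating-∈A⇒∉B alt i e∈A with alt | n%2≡0⊎n%2≡1 (toℕ i)
  ... | inj₁ fromA | inj₁ even = proj₂ (proj₁ (fromA i) even)
  ... | inj₁ fromA | inj₂ odd = contradiction e∈A (proj₂ (proj₂ (fromA i) odd))
  ... | inj₂ fromB | inj₁ even = contradiction e∈A (proj₂ (proj₁ (fromB i) even))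
  ... | inj₂ fromB | inj₂ odd = proj₂ (proj₂ (fromB i) odd)

  inMA⇒∉H : ∀ {M H e} → InMA G M H e → e ∉ H
  inMA⇒∉H (e∈M , P , ((alt , _) , _) , i , refl) = alternating-∈A⇒∉B {P = P} alt i e∈M

  maxSum⇒¬addable : ∀ {H H' e} → MaxSum G H H' → e ∉ H → ¬ Addable H' e
  maxSum⇒¬addable {H} {H'} {e} (b2 , bound) e∉H add =
    <-irrefl refl (<-≤-trans (+-monoʳ-< ∣ H ∣ larger) (bound H (H' ∪ ⁅ e ⁆) b2'))
    where
    larger : ∣ H' ∣ < ∣ H' ∪ ⁅ e ⁆ ∣
    larger = p⊂q⇒∣p∣<∣q∣ (x∉p⇒p⊂p∪⁅x⁆ (addable⇒∉ add))
    b2' : InB2 G H (H' ∪ ⁅ e ⁆)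
    b2' = ∪⁅⁆-inB2 b2 (λ g∈ → g∈) add e∉H

  standing⇒¬exchangeable : ∀ {H H' M e f} → StandingSetting G H H' M →
    e ∈ M → e ∉ H → f ∈ H' → f ∉ M → ¬ Addable (H' - f) e
  standing⇒¬exchangeable {H} {H'} {M} {e} {f}
    (((b2 , bound) , α₂-bound) , maxM , optimal) e∈M e∉H f∈H' f∉M add =
    <-irrefl refl (<-≤-trans (p⊂q⇒∣p∣<∣q∣ meetsMore) meetsNoMore)
    where
    K' : EdgeSet G
    K' = (H' - f) ∪ ⁅ e ⁆
    e∉H' : e ∉ H'
    e∉H' e∈H' = addable⇒∉ add (x∈p∧x≢y⇒x∈p-y e∈H' (λ { refl → f∉M e∈M }))
    noSmaller : ∣ H' ∣ ≤ ∣ K' ∣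
    noSmaller = subst (_≤ ∣ K' ∣) (sym (x∈p⇒∣p∣≡suc∣p-x∣ f∈H'))
      (p⊂q⇒∣p∣<∣q∣ (x∉p⇒p⊂p∪⁅x⁆ (addable⇒∉ add)))
    maxSum : MaxSum G H K'
    maxSum = ∪⁅⁆-inB2 b2 (p─q⊆p H' ⁅ f ⁆) add e∉H ,
      λ K K'' b → ≤-trans (bound K K'' b) (+-monoʳ-≤ ∣ H ∣ noSmaller)
    meetsNoMore : ∣ M ∩ K' ∣ ≤ ∣ M ∩ H' ∣
    meetsNoMore = proj₂ (optimal H K' M (maxSum , α₂-bound) maxM) refl
    M∩H'⊆M∩K' : M ∩ H' ⊆ M ∩ K'
    M∩H'⊆M∩K' {g} g∈ with x∈p∩q⁻ M H' g∈
    ... | g∈M , g∈H' = x∈p∩q⁺ (g∈M , x∈p∪q⁺ (inj₁ (x∈p∧x≢y⇒x∈p-y g∈H' λ { refl → f∉M g∈M })))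
    meetsMore : M ∩ H' ⊂ M ∩ K'
    meetsMore = M∩H'⊆M∩K' , e , x∈p∩q⁺ (e∈M , x∈p∪q⁺ (inj₂ (x∈⁅x⁆ e))) ,
      e∉H' ∘ proj₂ ∘ x∈p∩q⁻ M H'

  uncovered⇒addable : ∀ {P e v w} → Joins G e v w →
    ¬ Covered P v → ¬ Covered P w → Addable P e
  uncovered⇒addable j ¬v ¬w g g∈ s =
    [ (λ vg → ¬v (g , g∈ , vg)) , (λ wg → ¬w (g , g∈ , wg)) ]′ (joins⇒shareEnd-at j s)

  soleCover⇒addable : ∀ {P e f v w} → IsMatching G P → Joins G e v w →
    f ∈ P → Incident G v f → ¬ Covered P w → Addable (P - f) e
  soleCover⇒addable {P} {f = f} {v} matP j f∈P vf ¬w g g∈ s with joins⇒shareEnd-at j s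
  ... | inj₂ wg = ¬w (g , p─q⊆p P ⁅ f ⁆ g∈ , wg)
  ... | inj₁ vg = matP g f (p─q⊆p P ⁅ f ⁆ g∈) f∈P g≢f (v , vg , vf)
    where
    g≢f : g ≢ f
    g≢f refl = x∉p-x f P g∈

  joins-sym : ∀ {e v w} → Joins G e v w → Joins G e w v
  joins-sym (inj₁ (s , t)) = inj₂ (s , t)
  joins-sym (inj₂ (s , t)) = inj₁ (s , t)

  standing⇒end-covered : ∀ {H H' M e v w} → StandingSetting G H H' M →
    InMA G M H e → e ∉ H' → Joins G e v w → Covered H' v
  standing⇒end-covered {H} {H'} {M} {e} {v} {w}
    st@((maxSum@((_ , matH' , _) , _) , _) , (matM , _) , _) e∈MA e∉H' j
    with covered? H' v | covered? H' w
  ... | yes cv | _ = cv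
  ... | no ¬v | no ¬w =
    ⊥-elim (maxSum⇒¬addable maxSum (inMA⇒∉H e∈MA) (uncovered⇒addable j ¬v ¬w))
  ... | no ¬v | yes (f , f∈H' , wf) = ⊥-elim (standing⇒¬exchangeable st e∈M (inMA⇒∉H e∈MA)
        f∈H' f∉M (soleCover⇒addable matH' (joins-sym j) f∈H' wf ¬v))
    where
    e∈M : e ∈ M
    e∈M = proj₁ e∈MA
    f∉M : f ∉ M
    f∉M f∈M = matM e f e∈M f∈M (λ { refl → e∉H' f∈H' }) (w , joins⇒incident (joins-sym j) , wf)

lemma2 : (G : Graph) (H H' M : EdgeSet G) → StandingSetting G H H' M →
    ∀ (e : Fin (Graph.m G)) → InMA G M H e → e ∉ H' →
    ∃[ f ] ∃[ f' ] (f ≢ f' × f ∈ H' × f' ∈ H' × Adjacent G e f × Adjacent G e f')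
lemma2 G H H' M st e e∈MA e∉H'
  with standing⇒end-covered G st e∈MA e∉H' (inj₁ (refl , refl))
     | standing⇒end-covered G st e∈MA e∉H' (inj₂ (refl , refl))
... | f , f∈H' , sf | f' , f'∈H' , tf' =
  f , f' , f≢f' , f∈H' , f'∈H' , (e≢ f∈H' , _ , inj₁ refl , sf) , (e≢ f'∈H' , _ , inj₂ refl , tf')
  where
  e≢ : ∀ {g} → g ∈ H' → e ≢ g
  e≢ g∈H' refl = e∉H' g∈H'
  f≢f' : f ≢ f'
  f≢f' refl = e≢ f∈H' (incident-to-both-ends⇒≡ G sf tf')
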